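{- For all $c_u,c_v,c_t\in Q_n$ such that $c_u$ is a square generator (i.e. $c_u=c_{xx}$ for some $1<x<n$) and the words $c_u\cdot c_v$ and $c_v\cdot c_t$ are not Chinese normal forms, the rightmost rewriting path of $\mathrm{SRS}(Q_n,\mathbb{SC}_n)$ from $c_u\cdot c_v\cdot c_t$ to its normal form has length at most $5$: $\ell_r(c_u\cdot c_v\cdot c_t)\le5$.
   Context: Write $[n]=\{1,\ldots,n\}$. A (Chinese) staircase over $[n]$ is a family $t$ of non-negative integers $t_{ij}$ ($1\le j<i\le n$) and $t_i$ ($1\le i\le n$); write $t_{ii}=t_i$ (entry of row $i$, column $j$). $\mathrm{ChinT}_n$ is the set of staircases. Row reading $R_r(t)=w_1\cdots w_n$ with $w_i=(i1)^{t_{i1}}\cdots(i(i-1))^{t_{i(i-1)}}\,i^{t_i}$, $(ij)$ the two-letter word $ij$. For $n\ge2$ write $t=(t',R_1)$, $t'\in\mathrm{ChinT}_{n-1}$ (rows $1..n-1$), $R_1$ row $n$. Right insertion $C_r:\mathrm{ChinT}_n\times[n]\to\mathrm{ChinT}_n$ by induction on $n$: if $x=n$, increase $t_n$ by $1$. If $x<n$, let $y_1$ be the largest $j$ with $t_{nj}\ne0$ ($y_1=x$ if row $n$ is zero): (i) if $x\ge y_1$, $C_r(t,x)=(C_r(t',x),R_1)$; (ii) if $x<y_1<n$, $C_r(t,x)=(C_r(t',y_1),R_1')$, $R_1'$ obtained by decreasing $t_{ny_1}$ and increasing $t_{nx}$ by $1$; (iii) if $x<y_1=n$, $C_r(t,x)=(t',R_1')$,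 $R_1'$ obtained by decreasing $t_n$ and increasing $t_{nx}$ by $1$. Product $t\star_{C_r}t'=C_r(\ldots C_r(t,a_1)\ldots,a_k)$ with $a_1\ldots a_k=R_r(t')$. $Q_n\subseteq\mathrm{ChinT}_n$: $c_{yx}$ ($1\le x<y\le n$): $t_{yx}=1$, others $0$; $c_x$ ($1\le x\le n$): $t_x=1$, others $0$; $c_{xx}$ ($1<x<n$, square generators): $t_x=2$, others $0$. Reading $R_{Q_n}:\mathrm{ChinT}_n\to Q_n^\ast$: rows $i=1,\ldots,n$ in order, row $i$ read as $c_{i1}^{t_{i1}}\cdots c_{i(i-1)}^{t_{i(i-1)}}$ followed, for $1<i<n$, by $c_i\,c_{ii}^{(t_i-1)/2}$ ($t_i$ odd) or $c_{ii}^{t_i/2}$ ($t_i$ even), and for $i\in\{1,n\}$ by $c_i^{t_i}$. $\mathrm{SRS}(Q_n,\mathbb{SC}_n)$ is the rewriting system on $Q_n$ with rules $c_u\cdot c_v\to R_{Q_n}(c_u\star_{C_r}c_v)$ whenever $c_u\cdot c_v\ne R_{Q_n}(c_u\star_{C_r}c_v)$; it is terminating and confluent. A Chinese normal form is a word of $Q_n^\ast$ to which no rule applies. A rewriting step on $u$ is $w\gamma w'$ with $u=w\,s(\gamma)\,w'$; the rightmost step has $|w|$ maximal. $\ell_r(w)$ is the number of steps of the path from $w$ to its normal form obtained by iterating rightmost steps. -}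

module Defs where

open import Data.Nat using (ℕ; zero; suc; _+_; _∸_; _≤_; _<_; _≡ᵇ_; _<ᵇ_; _≤ᵇ_; _%_; _/_)
open import Data.Bool using (Bool; true; false; if_then_else_; _∧_)
open import Data.Maybe using (Maybe; just; nothing; fromMaybe)
open import Data.List using (List; []; _∷_; _++_; concatMap; replicate; applyUpTo; foldl)
open import Data.Product using (_×_; ∃-syntax)
open import Relation.Binary.PropositionalEquality using (_≡_; _≢_)
open import Relation.Nullary using (¬_)

-- A staircase over [n] is represented by its entry function t i j = t_{ij}
-- (only the entries with 1 ≤ j ≤ i ≤ n are meaningful; t i i = t_i).
Stair : Set
Stair = ℕ → ℕ → ℕ

upd : Stair → ℕ → ℕ → (ℕ → ℕ) → Stair
upd t i j f a b = if (a ≡ᵇ i) ∧ (b ≡ᵇ j) then f (t a b) else t a b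

lastNZ : (ℕ → ℕ) → ℕ → Maybe ℕ
lastNZ r zero = nothing
lastNZ r (suc k) = if r (suc k) ≡ᵇ 0 then lastNZ r k else just (suc k)

Cr : ℕ → Stair → ℕ → Stair
Cr zero t x = t
Cr (suc m) t x =
  if x ≡ᵇ suc m then upd t (suc m) (suc m) suc
  else if x <ᵇ suc m then
    (let y1 = fromMaybe x (lastNZ (t (suc m)) (suc m))
         t₁ = upd (upd t (suc m) y1 (λ k → k ∸ 1)) (suc m) x suc
     in if y1 ≤ᵇ x then Cr m t x
        else if y1 <ᵇ suc m then Cr m t₁ y1
        else t₁)
  else t

Rr : ℕ → Stair → List ℕ
Rr n t = concatMap row (applyUpTo suc n)
  where
  row : ℕ → List ℕ
  row i = concatMap (λ j → concatMap (λ _ → i ∷ j ∷ []) (replicate (t i j) i))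
                    (applyUpTo suc (i ∸ 1))
          ++ replicate (t i i) i

star : ℕ → Stair → Stair → Stair
star n t t' = foldl (Cr n) t (Rr n t')

-- generators: cyc y x = c_{yx}, col x = c_x, sq x = c_{xx}
data Gen : Set where
  cyc : ℕ → ℕ → Gen
  col : ℕ → Gen
  sq  : ℕ → Gen

InQ : ℕ → Gen → Set
InQ n (cyc y x) = 1 ≤ x × x < y × y ≤ n
InQ n (col x) = 1 ≤ x × x ≤ n
InQ n (sq x) = 1 < x × x < n

gen : Gen → Stair
gen (cyc y x) i j = if (i ≡ᵇ y) ∧ (j ≡ᵇ x) then 1 else 0
gen (col x) i j = if (i ≡ᵇ x) ∧ (j ≡ᵇ x) then 1 else 0
gen (sq x) i j = if (i ≡ᵇ x) ∧ (j ≡ᵇ x) then 2 else 0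

RQ : ℕ → Stair → List Gen
RQ n t = concatMap row (applyUpTo suc n)
  where
  diag : ℕ → List Gen
  diag i = if (1 <ᵇ i) ∧ (i <ᵇ n)
           then (if t i i % 2 ≡ᵇ 1 then col i ∷ replicate (t i i / 2) (sq i)
                 else replicate (t i i / 2) (sq i))
           else replicate (t i i) (col i)
  row : ℕ → List Gen
  row i = concatMap (λ j → replicate (t i j) (cyc i j)) (applyUpTo suc (i ∸ 1)) ++ diag i

Rule : ℕ → Gen → Gen → Set
Rule n a b = InQ n a × InQ n b × ((a ∷ b ∷ []) ≢ RQ n (star n (gen a) (gen b)))

IsNF : ℕ → List Gen → Set
IsNF n w = ∀ p a b q → w ≡ p ++ (a ∷ b ∷ q) → ¬ Rule n a b

-- rightmost rewriting step w → w': the rule applies at a position after which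
-- no rule applies (so |p| is maximal)
data RStep (n : ℕ) : List Gen → List Gen → Set where
  rstep : ∀ p a b q → Rule n a b → IsNF n (b ∷ q) →
          RStep n (p ++ (a ∷ b ∷ q)) (p ++ (RQ n (star n (gen a) (gen b)) ++ q))

-- RPath n w k : the rightmost path from w reaches a normal form in exactly k steps
-- (so RPath n w k holds iff ℓ_r(w) = k)
data RPath (n : ℕ) : List Gen → ℕ → Set where
  done : ∀ {w} → IsNF n w → RPath n w 0
  step : ∀ {w w' k} → RStep n w w' → RPath n w' k → RPath n w (suc k)

-- Inserting an index k ≥ 2 into [n-1], i.e. relabelling [n-1] increasingly onto [n] ∖ {k}, commutes
-- with right insertion and with both readings, so it carries rules, normal forms and rightmost paths
-- over [n-1] to those over [n]. A triple c_xx · c_v · c_t mentions at most five indices; if some index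
-- in {2, …, n-1} is unused, the triple comes from [n-1] and we conclude by induction. Otherwise
-- n ≤ 7, and those finitely many triples are settled by computing their rightmost paths.

module Submission where

open import Defs
open import Data.Bool using (true; false; T; if_then_else_; _∧_; _∨_)
open import Data.Bool.Properties using (T?; ∧-zeroʳ; ∨-zeroʳ)
open import Data.Empty using (⊥-elim)
open import Data.Fin using (Fin; toℕ)
open import Data.Fin.Properties using (pigeonhole; toℕ-injective; toℕ<n)
open import Data.List using (List; []; _∷_; _++_; [_]; concatMap; replicate; applyUpTo; foldl; map; length; lookup)
open import Data.List.Properties
  using (concatMap-cong; map-concatMap; concatMap-++; map-++; map-replicate; applyUpTo-∷ʳ; ++-identityʳ;
         ∷-injectiveʳ; map-injective; length-++; ≡-dec)
open import Data.List.Membership.Propositional using (_∈_; _∉_)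
open import Data.List.Membership.Propositional.Properties using (∈-++⁺ˡ; ∈-++⁺ʳ)
open import Data.List.Relation.Unary.Any as Any using (here; there)
open import Data.List.Relation.Unary.Any.Properties using (lookup-index)
open import Data.Maybe using (Maybe; just; nothing; fromMaybe; is-just; to-witness-T) renaming (map to mapMaybe)
open import Data.Nat
open import Data.Nat.Properties
open import Data.List.Membership.DecPropositional Data.Nat.Properties._≟_ using (_∈?_)
open import Data.Product using (_×_; _,_; ∃-syntax)
open import Data.Sum using (inj₁; inj₂)
open import Function using (_∘_; mk⇔; Injective)
open import Relation.Binary.Definitions using (DecidableEquality; tri<; tri≈; tri>)
open import Relation.Binary.PropositionalEquality
  using (_≡_; _≢_; _≗_; refl; sym; trans; cong; cong₂; subst; subst₂; module ≡-Reasoning)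
open import Relation.Nullary using (¬_; Dec; yes; no; ¬?)
open import Relation.Nullary.Decidable using (map′; _×-dec_; _→-dec_; toWitness; dec-true; dec-false; does-⇔; decidable-stable)
open import Relation.Unary using (Pred; Decidable)

_≗₂_ : Stair → Stair → Set
s ≗₂ s' = ∀ i j → s i j ≡ s' i j

≗₂-trans : ∀ {r s t} → r ≗₂ s → s ≗₂ t → r ≗₂ t
≗₂-trans p q i j = trans (p i j) (q i j)

upd-cong : ∀ {s s'} i j f → s ≗₂ s' → upd s i j f ≗₂ upd s' i j f
upd-cong i j f e a b rewrite e a b = refl

lastNZ-cong : ∀ {r r' : ℕ → ℕ} → r ≗ r' → ∀ c → lastNZ r c ≡ lastNZ r' c
lastNZ-cong e zero = refl
lastNZ-cong e (suc c) rewrite e (suc c) | lastNZ-cong e c = refl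

lastNZ-zero : ∀ {r : ℕ → ℕ} → (∀ j → r j ≡ 0) → ∀ c → lastNZ r c ≡ nothing
lastNZ-zero z zero = refl
lastNZ-zero z (suc c) rewrite z (suc c) = lastNZ-zero z c

-- gen (cyc y x), gen (col x) and gen (sq x) are entry y x 1, entry x x 1 and entry x x 2.
entry : ℕ → ℕ → ℕ → Stair
entry y x v i j = if (i ≡ᵇ y) ∧ (j ≡ᵇ x) then v else 0

transfer : Stair → ℕ → ℕ → ℕ → Stair
transfer t M y x = upd (upd t M y (_∸ 1)) M x suc

-- Cr (suc m) t x unfolds definitionally to CrStep (suc m) (Cr m) t x y₁, with y₁ as in the definition of Cr.
CrStep : ℕ → (Stair → ℕ → Stair) → Stair → ℕ → ℕ → Stair
CrStep M rec t x y₁ =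
  if x ≡ᵇ M then upd t M M suc
  else if x <ᵇ M then
    (if y₁ ≤ᵇ x then rec t x
     else if y₁ <ᵇ M then rec (transfer t M y₁ x) y₁
     else transfer t M y₁ x)
  else t

CrStep-cong : ∀ M rec → (∀ {s s'} x → s ≗₂ s' → rec s x ≗₂ rec s' x) →
              ∀ {s s'} x y → s ≗₂ s' → CrStep M rec s x y ≗₂ CrStep M rec s' x y
CrStep-cong M rec rec-cong x y e with x ≡ᵇ M | x <ᵇ M | y ≤ᵇ x | y <ᵇ M
... | true | _ | _ | _ = upd-cong M M suc e
... | false | false | _ | _ = e
... | false | true | true | _ = rec-cong x e
... | false | true | false | true = rec-cong y (upd-cong M x suc (upd-cong M y (_∸ 1) e))
... | false | true | false | false = upd-cong M x suc (upd-cong M y (_∸ 1) e)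

Cr-cong : ∀ m {s s'} x → s ≗₂ s' → Cr m s x ≗₂ Cr m s' x
Cr-cong zero x e = e
Cr-cong (suc m) {s} {s'} x e i j =
  trans (cong (λ y → CrStep (suc m) (Cr m) s x y i j) (cong (fromMaybe x) (lastNZ-cong (e (suc m)) (suc m))))
        (CrStep-cong (suc m) (Cr m) (Cr-cong m) x (fromMaybe x (lastNZ (s' (suc m)) (suc m))) e i j)

Cr-above : ∀ m s y → m < y → Cr m s y ≡ s
Cr-above zero s y p = refl
Cr-above (suc m) s y p rewrite dec-false (y ≟ suc m) (>⇒≢ p) | dec-false (y <? suc m) (<⇒≯ p) = refl

Cr-zero-row : ∀ m s y → y ≢ suc m → (∀ j → s (suc m) j ≡ 0) → Cr (suc m) s y ≡ Cr m s y
Cr-zero-row m s y y≢ z with y <? suc m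
... | yes p rewrite dec-false (y ≟ suc m) y≢ | dec-true (y <? suc m) p
                  | lastNZ-zero z (suc m) | dec-true (y ≤? y) ≤-refl = refl
... | no p = trans (Cr-above (suc m) s y y>) (sym (Cr-above m s y (<-trans (n<1+n m) y>)))
  where
  y> : suc m < y
  y> = ≤∧≢⇒< (≮⇒≥ p) (y≢ ∘ sym)

prefix : {A : Set} → (ℕ → List A) → ℕ → List A
prefix g m = concatMap g (applyUpTo suc m)

prefix-suc : ∀ {A : Set} (g : ℕ → List A) m → prefix g (suc m) ≡ prefix g m ++ g (suc m)
prefix-suc g m = begin
  concatMap g (applyUpTo suc (suc m))       ≡⟨ cong (concatMap g) (sym (applyUpTo-∷ʳ suc m)) ⟩
  concatMap g (applyUpTo suc m ++ [ suc m ]) ≡⟨ concatMap-++ g (applyUpTo suc m) [ suc m ] ⟩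
  prefix g m ++ g (suc m) ++ []             ≡⟨ cong (prefix g m ++_) (++-identityʳ (g (suc m))) ⟩
  prefix g m ++ g (suc m)                   ∎
  where open ≡-Reasoning

prefix-cong : ∀ {A : Set} {g g' : ℕ → List A} → g ≗ g' → ∀ n → prefix g n ≡ prefix g' n
prefix-cong e n = concatMap-cong e (applyUpTo suc n)

prefix-[] : ∀ {A : Set} {g : ℕ → List A} → (∀ i → g i ≡ []) → ∀ n → prefix g n ≡ []
prefix-[] {g = g} e zero = refl
prefix-[] {g = g} e (suc n) = trans (prefix-suc g n) (cong₂ _++_ (prefix-[] e n) (e (suc n)))

map-prefix : ∀ {A B : Set} (f : A → B) (g : ℕ → List A) n → map f (prefix g n) ≡ prefix (map f ∘ g) n
map-prefix f g n = map-concatMap f g (applyUpTo suc n)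

-- R_r and R_{Q_n} both have this shape: row by row, the entries t_{ij} (j < i) and then t_i.
reading : {A : Set} → (ℕ → ℕ → ℕ → List A) → (ℕ → ℕ → List A) → ℕ → Stair → List A
reading cell diag n t = prefix (λ i → prefix (λ j → cell i j (t i j)) (i ∸ 1) ++ diag i (t i i)) n

reading-cong : ∀ {A : Set} cell diag n {t t'} → t ≗₂ t' → reading {A} cell diag n t ≡ reading cell diag n t'
reading-cong cell diag n {t} {t'} e =
  prefix-cong (λ i → cong₂ _++_ (prefix-cong (λ j → cong (cell i j) (e i j)) (i ∸ 1)) (cong (diag i) (e i i))) n

pairCells : ℕ → ℕ → ℕ → List ℕ
pairCells i j c = concatMap (λ _ → i ∷ j ∷ []) (replicate c i)

diagLetters : ℕ → ℕ → List ℕ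
diagLetters i c = replicate c i

genCells : ℕ → ℕ → ℕ → List Gen
genCells i j c = replicate c (cyc i j)

diagGens : ℕ → ℕ → ℕ → List Gen
diagGens n i c =
  if (1 <ᵇ i) ∧ (i <ᵇ n)
  then (if c % 2 ≡ᵇ 1 then col i ∷ replicate (c / 2) (sq i) else replicate (c / 2) (sq i))
  else replicate c (col i)

rhs : ℕ → Gen → Gen → List Gen
rhs n a b = RQ n (star n (gen a) (gen b))

IsNF-[] : ∀ {n} → IsNF n []
IsNF-[] [] _ _ _ ()
IsNF-[] (_ ∷ _) _ _ _ ()

IsNF-[_] : ∀ {n} c → IsNF n (c ∷ [])
IsNF-[ c ] [] _ _ _ ()
IsNF-[ c ] (_ ∷ []) _ _ _ ()
IsNF-[ c ] (_ ∷ _ ∷ _) _ _ _ ()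

IsNF-∷ : ∀ {n a b w} → ¬ Rule n a b → IsNF n (b ∷ w) → IsNF n (a ∷ b ∷ w)
IsNF-∷ ¬r nf [] _ _ _ refl = ¬r
IsNF-∷ ¬r nf (_ ∷ p) a b q e = nf p a b q (∷-injectiveʳ e)

IsNF-head : ∀ {n a b w} → IsNF n (a ∷ b ∷ w) → ¬ Rule n a b
IsNF-head {w = w} nf = nf [] _ _ w refl

IsNF-tail : ∀ {n a w} → IsNF n (a ∷ w) → IsNF n w
IsNF-tail {a = a} nf p b c q e = nf (a ∷ p) b c q (cong (a ∷_) e)

RStep-∷ : ∀ {n w w'} a → RStep n w w' → RStep n (a ∷ w) (a ∷ w')
RStep-∷ a (rstep p b c q r nf) = rstep (a ∷ p) b c q r nf

RPathWithin : ℕ → ℕ → List Gen → Set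
RPathWithin f n w = ∃[ ℓ ] (RPath n w ℓ × ℓ ≤ f)

TripleBound : ℕ → Gen → Gen → Gen → Set
TripleBound n u v t = InQ n u → InQ n v → InQ n t → Rule n u v → Rule n v t → RPathWithin 5 n (u ∷ v ∷ t ∷ [])

TripleBound-cong : ∀ {n u u' v v' t t'} → u ≡ u' → v ≡ v' → t ≡ t' → TripleBound n u v t → TripleBound n u' v' t'
TripleBound-cong refl refl refl bound = bound

indices : Gen → List ℕ
indices (cyc y x) = y ∷ x ∷ []
indices (col x) = x ∷ []
indices (sq x) = x ∷ []

-- Inserting an unused index

-- 2 ≤ k keeps 1 fixed, so the bounds 1 ≤ x and 1 < x defining Q_n are preserved.
module Insertion (k : ℕ) (2≤k : 2 ≤ k) where

  shift : ℕ → ℕ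
  shift i = if i <ᵇ k then i else suc i

  shift-< : ∀ {i} → i < k → shift i ≡ i
  shift-< {i} p rewrite dec-true (i <? k) p = refl

  shift-≥ : ∀ {i} → k ≤ i → shift i ≡ suc i
  shift-≥ {i} p rewrite dec-false (i <? k) (≤⇒≯ p) = refl

  shift-1 : shift 1 ≡ 1
  shift-1 = shift-< 2≤k

  shift-0 : shift 0 ≡ 0
  shift-0 = shift-< (<-trans z<s 2≤k)

  shift-mono-< : ∀ {a b} → a < b → shift a < shift b
  shift-mono-< {a} {b} p with a <? k | b <? k
  ... | yes pa | yes pb rewrite shift-< pa | shift-< pb = p
  ... | yes pa | no pb rewrite shift-< pa | shift-≥ (≮⇒≥ pb) = m≤n⇒m≤1+n p
  ... | no pa | yes pb = ⊥-elim (pa (<-trans p pb))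
  ... | no pa | no pb rewrite shift-≥ (≮⇒≥ pa) | shift-≥ (≮⇒≥ pb) = s≤s p

  shift-cancel-< : ∀ {a b} → shift a < shift b → a < b
  shift-cancel-< {a} {b} p with a <? b
  ... | yes q = q
  ... | no q with m≤n⇒m<n∨m≡n (≮⇒≥ q)
  ...   | inj₁ b<a = ⊥-elim (<-asym p (shift-mono-< b<a))
  ...   | inj₂ refl = ⊥-elim (<-irrefl refl p)

  shift-mono-≤ : ∀ {a b} → a ≤ b → shift a ≤ shift b
  shift-mono-≤ p = ≮⇒≥ (λ q → <⇒≱ (shift-cancel-< q) p)

  shift-cancel-≤ : ∀ {a b} → shift a ≤ shift b → a ≤ b
  shift-cancel-≤ p = ≮⇒≥ (λ q → <⇒≱ (shift-mono-< q) p)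

  shift-injective : ∀ {a b} → shift a ≡ shift b → a ≡ b
  shift-injective p = ≤-antisym (shift-cancel-≤ (≤-reflexive p)) (shift-cancel-≤ (≤-reflexive (sym p)))

  shift≢k : ∀ i → shift i ≢ k
  shift≢k i e with i <? k
  ... | yes p = <⇒≢ p (trans (sym (shift-< p)) e)
  ... | no p = <⇒≢ (s≤s (≮⇒≥ p)) (sym (trans (sym (shift-≥ (≮⇒≥ p))) e))

  shift-≡ᵇ : ∀ a b → (shift a ≡ᵇ shift b) ≡ (a ≡ᵇ b)
  shift-≡ᵇ a b = does-⇔ (mk⇔ shift-injective (cong shift)) (shift a ≟ shift b) (a ≟ b)

  shift-<ᵇ : ∀ a b → (shift a <ᵇ shift b) ≡ (a <ᵇ b)
  shift-<ᵇ a b = does-⇔ (mk⇔ shift-cancel-< shift-mono-<) (shift a <? shift b) (a <? b)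

  shift-≤ᵇ : ∀ a b → (shift a ≤ᵇ shift b) ≡ (a ≤ᵇ b)
  shift-≤ᵇ a b = does-⇔ (mk⇔ shift-cancel-≤ shift-mono-≤) (shift a ≤? shift b) (a ≤? b)

  shift-≡ᵇk : ∀ i → (shift i ≡ᵇ k) ≡ false
  shift-≡ᵇk i = dec-false (shift i ≟ k) (shift≢k i)

  k≡ᵇshift : ∀ i → (k ≡ᵇ shift i) ≡ false
  k≡ᵇshift i = dec-false (k ≟ shift i) (shift≢k i ∘ sym)

  k≡ᵇk : (k ≡ᵇ k) ≡ true
  k≡ᵇk = dec-true (k ≟ k) refl

  unshift : ℕ → ℕ
  unshift i = if k <ᵇ i then pred i else i

  unshift-shift : ∀ i → unshift (shift i) ≡ i
  unshift-shift i with i <? k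
  ... | yes p rewrite shift-< p | dec-false (k <? i) (<⇒≯ p) = refl
  ... | no p rewrite shift-≥ (≮⇒≥ p) | dec-true (k <? suc i) (s≤s (≮⇒≥ p)) = refl

  shift-unshift : ∀ i → i ≢ k → shift (unshift i) ≡ i
  shift-unshift zero ne rewrite dec-false (k <? 0) λ () = shift-0
  shift-unshift (suc i) ne with k <? suc i
  ... | yes p rewrite dec-true (k <? suc i) p = shift-≥ (≤-pred p)
  ... | no p rewrite dec-false (k <? suc i) p = shift-< (≤∧≢⇒< (≮⇒≥ p) ne)

  shiftˢ : Stair → Stair
  shiftˢ t i j = if (i ≡ᵇ k) ∨ (j ≡ᵇ k) then 0 else t (unshift i) (unshift j)

  shiftˢ-shift : ∀ t i j → shiftˢ t (shift i) (shift j) ≡ t i j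
  shiftˢ-shift t i j rewrite shift-≡ᵇk i | shift-≡ᵇk j | unshift-shift i | unshift-shift j = refl

  shiftˢ-row-k : ∀ t j → shiftˢ t k j ≡ 0
  shiftˢ-row-k t j rewrite k≡ᵇk = refl

  shiftˢ-column-k : ∀ t i → shiftˢ t i k ≡ 0
  shiftˢ-column-k t i rewrite k≡ᵇk | ∨-zeroʳ (i ≡ᵇ k) = refl

  ≗₂-shiftˢ : ∀ (s t : Stair) → (∀ j → s k j ≡ 0) → (∀ i → s i k ≡ 0) →
              (∀ i j → s (shift i) (shift j) ≡ t i j) → s ≗₂ shiftˢ t
  ≗₂-shiftˢ s t row column off a b with a ≟ k | b ≟ k
  ... | yes refl | _ = trans (row b) (sym (shiftˢ-row-k t b))
  ... | no _ | yes refl = trans (column a) (sym (shiftˢ-column-k t a))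
  ... | no a≢k | no b≢k = begin
    s a b                                     ≡⟨ sym (cong₂ s (shift-unshift a a≢k) (shift-unshift b b≢k)) ⟩
    s (shift (unshift a)) (shift (unshift b)) ≡⟨ off (unshift a) (unshift b) ⟩
    t (unshift a) (unshift b)                 ≡⟨ sym (shiftˢ-shift t (unshift a) (unshift b)) ⟩
    shiftˢ t (shift (unshift a)) (shift (unshift b)) ≡⟨ cong₂ (shiftˢ t) (shift-unshift a a≢k) (shift-unshift b b≢k) ⟩
    shiftˢ t a b                              ∎
    where open ≡-Reasoning

  upd-shift : ∀ t i j f → upd (shiftˢ t) (shift i) (shift j) f ≗₂ shiftˢ (upd t i j f)
  upd-shift t i j f = ≗₂-shiftˢ _ _ row column off
    where
    row : ∀ b → upd (shiftˢ t) (shift i) (shift j) f k b ≡ 0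
    row b rewrite k≡ᵇshift i = shiftˢ-row-k t b
    column : ∀ a → upd (shiftˢ t) (shift i) (shift j) f a k ≡ 0
    column a rewrite k≡ᵇshift j | ∧-zeroʳ (a ≡ᵇ shift i) = shiftˢ-column-k t a
    off : ∀ a b → upd (shiftˢ t) (shift i) (shift j) f (shift a) (shift b) ≡ upd t i j f a b
    off a b rewrite shift-≡ᵇ a i | shift-≡ᵇ b j | shiftˢ-shift t a b = refl

  lastNZ-shift-suc : ∀ (R : ℕ → ℕ) → R k ≡ 0 → ∀ c →
    lastNZ R (shift (suc c)) ≡ (if R (shift (suc c)) ≡ᵇ 0 then lastNZ R (shift c) else just (shift (suc c)))
  lastNZ-shift-suc R Rk c with <-cmp (suc c) k
  ... | tri< p _ _ rewrite shift-< p | shift-< (<-trans (n<1+n c) p) = refl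
  ... | tri> _ _ p rewrite shift-≥ (<⇒≤ p) | shift-≥ (≤-pred p) = refl
  ... | tri≈ _ p _ rewrite shift-≥ (≤-reflexive (sym p)) | shift-< (subst (c <_) p (n<1+n c)) | sym p | Rk = refl

  lastNZ-shift : ∀ (R : ℕ → ℕ) → R k ≡ 0 → ∀ c → lastNZ R (shift c) ≡ mapMaybe shift (lastNZ (R ∘ shift) c)
  lastNZ-shift R Rk zero rewrite shift-0 = refl
  lastNZ-shift R Rk (suc c) rewrite lastNZ-shift-suc R Rk c | lastNZ-shift R Rk c with R (shift (suc c)) ≡ᵇ 0
  ... | true = refl
  ... | false = refl

  transfer-shift : ∀ t M y x → transfer (shiftˢ t) (shift M) (shift y) (shift x) ≗₂ shiftˢ (transfer t M y x)
  transfer-shift t M y x =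
    ≗₂-trans (upd-cong (shift M) (shift x) suc (upd-shift t M y (_∸ 1))) (upd-shift (upd t M y (_∸ 1)) M x suc)

  CrStep-shift : ∀ M (rec rec' : Stair → ℕ → Stair) → (∀ {s s'} x → s ≗₂ s' → rec' s x ≗₂ rec' s' x) →
                 (∀ t x → rec' (shiftˢ t) (shift x) ≗₂ shiftˢ (rec t x)) →
                 ∀ t x y → CrStep (shift M) rec' (shiftˢ t) (shift x) (shift y) ≗₂ shiftˢ (CrStep M rec t x y)
  CrStep-shift M rec rec' rec'-cong rec-shift t x y
    rewrite shift-≡ᵇ x M | shift-<ᵇ x M | shift-≤ᵇ y x | shift-<ᵇ y M
    with x ≡ᵇ M | x <ᵇ M | y ≤ᵇ x | y <ᵇ M
  ... | true | _ | _ | _ = upd-shift t M M suc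
  ... | false | false | _ | _ = λ _ _ → refl
  ... | false | true | true | _ = rec-shift t x
  ... | false | true | false | true = ≗₂-trans (rec'-cong (shift y) (transfer-shift t M y x)) (rec-shift (transfer t M y x) y)
  ... | false | true | false | false = transfer-shift t M y x

  Cr-Commutes : ℕ → ℕ → Set
  Cr-Commutes L m = ∀ t x → Cr L (shiftˢ t) (shift x) ≗₂ shiftˢ (Cr m t x)

  Cr-shift-suc : ∀ m L → shift (suc m) ≡ suc L → Cr-Commutes L m → Cr-Commutes (shift (suc m)) (suc m)
  Cr-shift-suc m L eq IH t x i j = begin
    Cr (shift (suc m)) (shiftˢ t) (shift x) i j
      ≡⟨ cong (λ N → Cr N (shiftˢ t) (shift x) i j) eq ⟩
    CrStep (suc L) (Cr L) (shiftˢ t) (shift x) (fromMaybe (shift x) (lastNZ (shiftˢ t (suc L)) (suc L))) i j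
      ≡⟨ cong (λ N → CrStep N (Cr L) (shiftˢ t) (shift x) (fromMaybe (shift x) (lastNZ (shiftˢ t N) N)) i j) (sym eq) ⟩
    CrStep (shift (suc m)) (Cr L) (shiftˢ t) (shift x) (fromMaybe (shift x) (lastNZ R (shift (suc m)))) i j
      ≡⟨ cong (λ y → CrStep (shift (suc m)) (Cr L) (shiftˢ t) (shift x) y i j) y₁-shift ⟩
    CrStep (shift (suc m)) (Cr L) (shiftˢ t) (shift x) (shift y₁) i j
      ≡⟨ CrStep-shift (suc m) (Cr m) (Cr L) (Cr-cong L) IH t x y₁ i j ⟩
    shiftˢ (Cr (suc m) t x) i j ∎
    where
    open ≡-Reasoning
    R : ℕ → ℕ
    R = shiftˢ t (shift (suc m))
    y₁ : ℕ
    y₁ = fromMaybe x (lastNZ (t (suc m)) (suc m))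
    y₁-shift : fromMaybe (shift x) (lastNZ R (shift (suc m))) ≡ shift y₁
    y₁-shift rewrite lastNZ-shift R (shiftˢ-column-k t (shift (suc m))) (suc m) | lastNZ-cong (shiftˢ-shift t (suc m)) (suc m)
      with lastNZ (t (suc m)) (suc m)
    ... | just _ = refl
    ... | nothing = refl

  Cr-shift : ∀ m → Cr-Commutes (shift m) m
  Cr-shift zero t x rewrite shift-0 = λ _ _ → refl
  Cr-shift (suc m) with <-cmp (suc m) k
  ... | tri< p _ _ = Cr-shift-suc m m (shift-< p) (subst (λ N → Cr-Commutes N m) (shift-< (<-trans (n<1+n m) p)) (Cr-shift m))
  ... | tri> _ _ p = Cr-shift-suc m (suc m) (shift-≥ (<⇒≤ p)) (subst (λ N → Cr-Commutes N m) (shift-≥ (≤-pred p)) (Cr-shift m))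
  ... | tri≈ _ p _ = Cr-shift-suc m (suc m) (shift-≥ (≤-reflexive (sym p))) skip-row-k
    where
    skip-row-k : Cr-Commutes (suc m) m
    skip-row-k t x i j = begin
      Cr (suc m) (shiftˢ t) (shift x) i j
        ≡⟨ cong (λ c → c i j) (Cr-zero-row m (shiftˢ t) (shift x) (λ e → shift≢k x (trans e p)) (λ j → subst (λ r → shiftˢ t r j ≡ 0) (sym p) (shiftˢ-row-k t j))) ⟩
      Cr m (shiftˢ t) (shift x) i j
        ≡⟨ cong (λ N → Cr N (shiftˢ t) (shift x) i j) (sym (shift-< (subst (m <_) p (n<1+n m)))) ⟩
      Cr (shift m) (shiftˢ t) (shift x) i j
        ≡⟨ Cr-shift m t x i j ⟩
      shiftˢ (Cr m t x) i j ∎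
      where open ≡-Reasoning

  module _ {A : Set} (g : ℕ → List A) (gk : g k ≡ []) where

    prefix-k : ∀ m → suc m ≡ k → prefix g (suc m) ≡ prefix g m
    prefix-k m m+1≡k = begin
      prefix g (suc m)        ≡⟨ prefix-suc g m ⟩
      prefix g m ++ g (suc m) ≡⟨ cong (prefix g m ++_) (trans (cong g m+1≡k) gk) ⟩
      prefix g m ++ []        ≡⟨ ++-identityʳ (prefix g m) ⟩
      prefix g m              ∎
      where open ≡-Reasoning

    prefix-shift-suc : ∀ n → prefix g (shift (suc n)) ≡ prefix g (shift n) ++ g (shift (suc n))
    prefix-shift-suc n with <-cmp (suc n) k
    ... | tri< p _ _ rewrite shift-< p | shift-< (<-trans (n<1+n n) p) = prefix-suc g n
    ... | tri> _ _ p rewrite shift-≥ (<⇒≤ p) | shift-≥ (≤-pred p) = prefix-suc g (suc n)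
    ... | tri≈ _ p _ rewrite shift-≥ (≤-reflexive (sym p)) | shift-< (subst (n <_) p (n<1+n n)) =
      trans (prefix-suc g (suc n)) (cong (_++ g (suc (suc n))) (prefix-k n p))

    prefix-shift : ∀ n → prefix g (shift n) ≡ prefix (g ∘ shift) n
    prefix-shift zero rewrite shift-0 = refl
    prefix-shift (suc n) = begin
      prefix g (shift (suc n))                     ≡⟨ prefix-shift-suc n ⟩
      prefix g (shift n) ++ g (shift (suc n))      ≡⟨ cong (_++ g (shift (suc n))) (prefix-shift n) ⟩
      prefix (g ∘ shift) n ++ g (shift (suc n))    ≡⟨ sym (prefix-suc (g ∘ shift) n) ⟩
      prefix (g ∘ shift) (suc n)                   ∎
      where open ≡-Reasoning

    prefix-shift-∸1 : ∀ i → prefix g (shift i ∸ 1) ≡ prefix (g ∘ shift) (i ∸ 1)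
    prefix-shift-∸1 zero rewrite shift-0 = refl
    prefix-shift-∸1 (suc m) = trans below-k (prefix-shift m)
      where
      below-k : prefix g (shift (suc m) ∸ 1) ≡ prefix g (shift m)
      below-k with <-cmp (suc m) k
      ... | tri< p _ _ rewrite shift-< p | shift-< (<-trans (n<1+n m) p) = refl
      ... | tri> _ _ p rewrite shift-≥ (<⇒≤ p) | shift-≥ (≤-pred p) = refl
      ... | tri≈ _ p _ rewrite shift-≥ (≤-reflexive (sym p)) | shift-< (subst (m <_) p (n<1+n m)) = prefix-k m p

  reading-shift : ∀ {A : Set} (f : A → A) cell diag diag' →
    (∀ i j → cell i j 0 ≡ []) → (∀ i j c → cell (shift i) (shift j) c ≡ map f (cell i j c)) →
    diag' k 0 ≡ [] → (∀ i c → diag' (shift i) c ≡ map f (diag i c)) →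
    ∀ n t → reading cell diag' (shift n) (shiftˢ t) ≡ map f (reading cell diag n t)
  reading-shift f cell diag diag' cell-0 cell-shift diag'-0 diag-shift n t = begin
    prefix row' (shift n)                  ≡⟨ prefix-shift row' row'-k n ⟩
    prefix (row' ∘ shift) n                ≡⟨ prefix-cong row'-shift n ⟩
    prefix (map f ∘ row) n                 ≡⟨ sym (map-prefix f row n) ⟩
    map f (prefix row n)                   ∎
    where
    open ≡-Reasoning
    row' : ℕ → List _
    row' i = prefix (λ j → cell i j (shiftˢ t i j)) (i ∸ 1) ++ diag' i (shiftˢ t i i)
    row : ℕ → List _
    row i = prefix (λ j → cell i j (t i j)) (i ∸ 1) ++ diag i (t i i)
    row'-k : row' k ≡ []
    row'-k rewrite shiftˢ-row-k t k = cong₂ _++_ (prefix-[] (λ j → trans (cong (cell k j) (shiftˢ-row-k t j)) (cell-0 k j)) (k ∸ 1)) diag'-0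
    row'-shift : ∀ i → row' (shift i) ≡ map f (row i)
    row'-shift i = begin
      prefix (λ j → cell (shift i) j (shiftˢ t (shift i) j)) (shift i ∸ 1) ++ diag' (shift i) (shiftˢ t (shift i) (shift i))
        ≡⟨ cong₂ _++_ (prefix-shift-∸1 _ cell-k i) (cong (diag' (shift i)) (shiftˢ-shift t i i)) ⟩
      prefix (λ j → cell (shift i) (shift j) (shiftˢ t (shift i) (shift j))) (i ∸ 1) ++ diag' (shift i) (t i i)
        ≡⟨ cong₂ _++_ (prefix-cong (λ j → trans (cong (cell (shift i) (shift j)) (shiftˢ-shift t i j)) (cell-shift i j (t i j))) (i ∸ 1))
                      (diag-shift i (t i i)) ⟩
      prefix (λ j → map f (cell i j (t i j))) (i ∸ 1) ++ map f (diag i (t i i))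
        ≡⟨ cong (_++ map f (diag i (t i i))) (sym (map-prefix f (λ j → cell i j (t i j)) (i ∸ 1))) ⟩
      map f (prefix (λ j → cell i j (t i j)) (i ∸ 1)) ++ map f (diag i (t i i))
        ≡⟨ sym (map-++ f (prefix (λ j → cell i j (t i j)) (i ∸ 1)) (diag i (t i i))) ⟩
      map f (row i) ∎
      where
      cell-k : cell (shift i) k (shiftˢ t (shift i) k) ≡ []
      cell-k = trans (cong (cell (shift i) k) (shiftˢ-column-k t (shift i))) (cell-0 (shift i) k)

  pairCells-shift : ∀ i j c → pairCells (shift i) (shift j) c ≡ map shift (pairCells i j c)
  pairCells-shift i j zero = refl
  pairCells-shift i j (suc c) = cong (λ l → shift i ∷ shift j ∷ l) (pairCells-shift i j c)

  Rr-shift : ∀ n t → Rr (shift n) (shiftˢ t) ≡ map shift (Rr n t)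
  Rr-shift = reading-shift shift pairCells diagLetters diagLetters (λ _ _ → refl) pairCells-shift refl (λ i c → sym (map-replicate shift c i))

  shiftᴳ : Gen → Gen
  shiftᴳ (cyc y x) = cyc (shift y) (shift x)
  shiftᴳ (col x) = col (shift x)
  shiftᴳ (sq x) = sq (shift x)

  diagGens-shift : ∀ n i c → diagGens (shift n) (shift i) c ≡ map shiftᴳ (diagGens n i c)
  diagGens-shift n i c rewrite sym (cong (_<ᵇ shift i) shift-1) | shift-<ᵇ 1 i | shift-<ᵇ i n
    with (1 <ᵇ i) ∧ (i <ᵇ n) | c % 2 ≡ᵇ 1
  ... | true | true = cong (col (shift i) ∷_) (sym (map-replicate shiftᴳ (c / 2) (sq i)))
  ... | true | false = sym (map-replicate shiftᴳ (c / 2) (sq i))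
  ... | false | _ = sym (map-replicate shiftᴳ c (col i))

  diagGens-k : ∀ n → diagGens n k 0 ≡ []
  diagGens-k n with (1 <ᵇ k) ∧ (k <ᵇ n)
  ... | true = refl
  ... | false = refl

  RQ-shift : ∀ n t → RQ (shift n) (shiftˢ t) ≡ map shiftᴳ (RQ n t)
  RQ-shift n = reading-shift shiftᴳ genCells (diagGens n) (diagGens (shift n)) (λ _ _ → refl)
    (λ i j c → sym (map-replicate shiftᴳ c (cyc i j))) (diagGens-k (shift n)) (diagGens-shift n) n

  entry-shift : ∀ y x v → entry (shift y) (shift x) v ≗₂ shiftˢ (entry y x v)
  entry-shift y x v = ≗₂-shiftˢ _ _ row column off
    where
    row : ∀ j → entry (shift y) (shift x) v k j ≡ 0
    row j rewrite k≡ᵇshift y = refl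
    column : ∀ i → entry (shift y) (shift x) v i k ≡ 0
    column i rewrite k≡ᵇshift x | ∧-zeroʳ (i ≡ᵇ shift y) = refl
    off : ∀ i j → entry (shift y) (shift x) v (shift i) (shift j) ≡ entry y x v i j
    off i j rewrite shift-≡ᵇ i y | shift-≡ᵇ j x = refl

  gen-shift : ∀ a → gen (shiftᴳ a) ≗₂ shiftˢ (gen a)
  gen-shift (cyc y x) = entry-shift y x 1
  gen-shift (col x) = entry-shift x x 1
  gen-shift (sq x) = entry-shift x x 2

  foldl-Cr-shift : ∀ n w {s t} → s ≗₂ shiftˢ t → foldl (Cr (shift n)) s (map shift w) ≗₂ shiftˢ (foldl (Cr n) t w)
  foldl-Cr-shift n [] e = e
  foldl-Cr-shift n (x ∷ w) {s} {t} e = foldl-Cr-shift n w (≗₂-trans (Cr-cong (shift n) (shift x) e) (Cr-shift n t x))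

  rhs-shift : ∀ n a b → rhs (shift n) (shiftᴳ a) (shiftᴳ b) ≡ map shiftᴳ (rhs n a b)
  rhs-shift n a b = begin
    RQ (shift n) (foldl (Cr (shift n)) (gen (shiftᴳ a)) (Rr (shift n) (gen (shiftᴳ b))))
      ≡⟨ cong (λ w → RQ (shift n) (foldl (Cr (shift n)) (gen (shiftᴳ a)) w))
              (trans (reading-cong pairCells diagLetters (shift n) (gen-shift b)) (Rr-shift n (gen b))) ⟩
    RQ (shift n) (foldl (Cr (shift n)) (gen (shiftᴳ a)) (map shift (Rr n (gen b))))
      ≡⟨ reading-cong genCells (diagGens (shift n)) (shift n) (foldl-Cr-shift n (Rr n (gen b)) (gen-shift a)) ⟩
    RQ (shift n) (shiftˢ (star n (gen a) (gen b)))
      ≡⟨ RQ-shift n _ ⟩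
    map shiftᴳ (rhs n a b) ∎
    where open ≡-Reasoning

  unshiftᴳ : Gen → Gen
  unshiftᴳ (cyc y x) = cyc (unshift y) (unshift x)
  unshiftᴳ (col x) = col (unshift x)
  unshiftᴳ (sq x) = sq (unshift x)

  unshiftᴳ-shiftᴳ : ∀ a → unshiftᴳ (shiftᴳ a) ≡ a
  unshiftᴳ-shiftᴳ (cyc y x) = cong₂ cyc (unshift-shift y) (unshift-shift x)
  unshiftᴳ-shiftᴳ (col x) = cong col (unshift-shift x)
  unshiftᴳ-shiftᴳ (sq x) = cong sq (unshift-shift x)

  shiftᴳ-injective : ∀ {a b} → shiftᴳ a ≡ shiftᴳ b → a ≡ b
  shiftᴳ-injective {a} {b} e = trans (sym (unshiftᴳ-shiftᴳ a)) (trans (cong unshiftᴳ e) (unshiftᴳ-shiftᴳ b))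

  1<shift⁺ : ∀ {x} → 1 < x → 1 < shift x
  1<shift⁺ p = subst (_< shift _) shift-1 (shift-mono-< p)

  1≤shift⁺ : ∀ {x} → 1 ≤ x → 1 ≤ shift x
  1≤shift⁺ p = subst (_≤ shift _) shift-1 (shift-mono-≤ p)

  1<shift⁻ : ∀ {x} → 1 < shift x → 1 < x
  1<shift⁻ p = shift-cancel-< (subst (_< shift _) (sym shift-1) p)

  1≤shift⁻ : ∀ {x} → 1 ≤ shift x → 1 ≤ x
  1≤shift⁻ p = shift-cancel-≤ (subst (_≤ shift _) (sym shift-1) p)

  InQ-shift : ∀ n a → InQ n a → InQ (shift n) (shiftᴳ a)
  InQ-shift n (cyc y x) (p , q , r) = 1≤shift⁺ p , shift-mono-< q , shift-mono-≤ r
  InQ-shift n (col x) (p , q) = 1≤shift⁺ p , shift-mono-≤ q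
  InQ-shift n (sq x) (p , q) = 1<shift⁺ p , shift-mono-< q

  InQ-unshift : ∀ n a → InQ (shift n) (shiftᴳ a) → InQ n a
  InQ-unshift n (cyc y x) (p , q , r) = 1≤shift⁻ p , shift-cancel-< q , shift-cancel-≤ r
  InQ-unshift n (col x) (p , q) = 1≤shift⁻ p , shift-cancel-≤ q
  InQ-unshift n (sq x) (p , q) = 1<shift⁻ p , shift-cancel-< q

  Rule-shift : ∀ n a b → Rule n a b → Rule (shift n) (shiftᴳ a) (shiftᴳ b)
  Rule-shift n a b (qa , qb , ne) =
    InQ-shift n a qa , InQ-shift n b qb , λ e → ne (map-injective shiftᴳ-injective (trans e (rhs-shift n a b)))

  Rule-unshift : ∀ n a b → Rule (shift n) (shiftᴳ a) (shiftᴳ b) → Rule n a b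
  Rule-unshift n a b (qa , qb , ne) =
    InQ-unshift n a qa , InQ-unshift n b qb , λ e → ne (trans (cong (map shiftᴳ) e) (sym (rhs-shift n a b)))

  IsNF-shift : ∀ n w → IsNF n w → IsNF (shift n) (map shiftᴳ w)
  IsNF-shift n [] nf = IsNF-[]
  IsNF-shift n (a ∷ []) nf = IsNF-[ shiftᴳ a ]
  IsNF-shift n (a ∷ b ∷ w) nf =
    IsNF-∷ (IsNF-head nf ∘ Rule-unshift n a b) (IsNF-shift n (b ∷ w) (IsNF-tail nf))

  RStep-shift : ∀ n {w w'} → RStep n w w' → RStep (shift n) (map shiftᴳ w) (map shiftᴳ w')
  RStep-shift n (rstep p a b q r nf) =
    subst₂ (RStep (shift n)) (sym (map-++ shiftᴳ p (a ∷ b ∷ q))) reduct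
      (rstep (map shiftᴳ p) (shiftᴳ a) (shiftᴳ b) (map shiftᴳ q) (Rule-shift n a b r) (IsNF-shift n (b ∷ q) nf))
    where
    reduct : map shiftᴳ p ++ (rhs (shift n) (shiftᴳ a) (shiftᴳ b) ++ map shiftᴳ q) ≡ map shiftᴳ (p ++ (rhs n a b ++ q))
    reduct rewrite rhs-shift n a b | map-++ shiftᴳ p (rhs n a b ++ q) | map-++ shiftᴳ (rhs n a b) q = refl

  RPath-shift : ∀ n {w c} → RPath n w c → RPath (shift n) (map shiftᴳ w) c
  RPath-shift n (done nf) = done (IsNF-shift n _ nf)
  RPath-shift n (step s p) = step (RStep-shift n s) (RPath-shift n p)

  shiftᴳ-unshiftᴳ : ∀ g → k ∉ indices g → shiftᴳ (unshiftᴳ g) ≡ g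
  shiftᴳ-unshiftᴳ (cyc y x) k∉ = cong₂ cyc (shift-unshift y (k∉ ∘ here ∘ sym)) (shift-unshift x (k∉ ∘ there ∘ here ∘ sym))
  shiftᴳ-unshiftᴳ (col x) k∉ = cong col (shift-unshift x (k∉ ∘ here ∘ sym))
  shiftᴳ-unshiftᴳ (sq x) k∉ = cong sq (shift-unshift x (k∉ ∘ here ∘ sym))

  TripleBound-shift : ∀ n u v t → TripleBound n u v t → TripleBound (shift n) (shiftᴳ u) (shiftᴳ v) (shiftᴳ t)
  TripleBound-shift n u v t bound qu qv qt r₁ r₂
    with bound (InQ-unshift n u qu) (InQ-unshift n v qv) (InQ-unshift n t qt) (Rule-unshift n u v r₁) (Rule-unshift n v t r₂)
  ... | ℓ , path , ℓ≤5 = ℓ , RPath-shift n path , ℓ≤5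

  TripleBound-unshift : ∀ n u v t → k ∉ indices u ++ indices v ++ indices t →
                        TripleBound n (unshiftᴳ u) (unshiftᴳ v) (unshiftᴳ t) → TripleBound (shift n) u v t
  TripleBound-unshift n u v t k∉ bound =
    TripleBound-cong (shiftᴳ-unshiftᴳ u (k∉ ∘ ∈-++⁺ˡ))
                     (shiftᴳ-unshiftᴳ v (k∉ ∘ ∈-++⁺ʳ (indices u) ∘ ∈-++⁺ˡ))
                     (shiftᴳ-unshiftᴳ t (k∉ ∘ ∈-++⁺ʳ (indices u) ∘ ∈-++⁺ʳ (indices v)))
                     (TripleBound-shift n _ _ _ bound)

-- Computing rightmost paths

_≟ᴳ_ : DecidableEquality Gen
cyc y x ≟ᴳ cyc y' x' = map′ (λ (p , q) → cong₂ cyc p q) (λ { refl → refl , refl }) (y ≟ y' ×-dec x ≟ x')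
col x ≟ᴳ col x' = map′ (cong col) (λ { refl → refl }) (x ≟ x')
sq x ≟ᴳ sq x' = map′ (cong sq) (λ { refl → refl }) (x ≟ x')
cyc _ _ ≟ᴳ col _ = no λ ()
cyc _ _ ≟ᴳ sq _ = no λ ()
col _ ≟ᴳ cyc _ _ = no λ ()
col _ ≟ᴳ sq _ = no λ ()
sq _ ≟ᴳ cyc _ _ = no λ ()
sq _ ≟ᴳ col _ = no λ ()

InQ? : ∀ n g → Dec (InQ n g)
InQ? n (cyc y x) = 1 ≤? x ×-dec x <? y ×-dec y ≤? n
InQ? n (col x) = 1 ≤? x ×-dec x ≤? n
InQ? n (sq x) = 1 <? x ×-dec x <? n

Rule? : ∀ n a b → Dec (Rule n a b)
Rule? n a b = InQ? n a ×-dec InQ? n b ×-dec ¬? (≡-dec _≟ᴳ_ (a ∷ b ∷ []) (rhs n a b))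

¬IsNF⇒Rule : ∀ {n a b} → ¬ IsNF n (a ∷ b ∷ []) → Rule n a b
¬IsNF⇒Rule {n} {a} {b} ¬nf = decidable-stable (Rule? n a b) (λ ¬r → ¬nf (IsNF-∷ ¬r IsNF-[ b ]))

data Rightmost (n : ℕ) (w : List Gen) : Set where
  normal : IsNF n w → Rightmost n w
  reduces : ∀ {w'} → RStep n w w' → Rightmost n w

rightmost : ∀ n w → Rightmost n w
rightmost n [] = normal IsNF-[]
rightmost n (a ∷ []) = normal IsNF-[ a ]
rightmost n (a ∷ b ∷ w) with rightmost n (b ∷ w)
... | reduces s = reduces (RStep-∷ a s)
... | normal nf with Rule? n a b
...   | yes r = reduces (rstep [] a b w r nf)
...   | no ¬r = normal (IsNF-∷ ¬r nf)

rpathWithin : ∀ f n w → Maybe (RPathWithin f n w)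
rpathWithin f n w with rightmost n w
... | normal nf = just (0 , done nf , z≤n)
rpathWithin zero n w | reduces s = nothing
rpathWithin (suc f) n w | reduces s = mapMaybe (λ (ℓ , p , ℓ≤f) → suc ℓ , step s p , s≤s ℓ≤f) (rpathWithin f n _)

-- Crowded triples

Crowded : ℕ → List ℕ → Set
Crowded n l = ∀ {j} → j < n → 2 ≤ j → j ∈ l

crowded? : ∀ n l → Dec (Crowded n l)
crowded? n l = allUpTo? (λ j → 2 ≤? j →-dec j ∈? l) n

FreeIndex : ℕ → List ℕ → Set
FreeIndex n l = ∃[ j ] (j < n × 2 ≤ j × j ∉ l)

freeIndex? : ∀ n l → Dec (FreeIndex n l)
freeIndex? n l = anyUpTo? (λ j → 2 ≤? j ×-dec ¬? (j ∈? l)) n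

¬FreeIndex⇒Crowded : ∀ {n l} → ¬ FreeIndex n l → Crowded n l
¬FreeIndex⇒Crowded {n} {l} ¬free {j} j<n 2≤j = decidable-stable (j ∈? l) (λ j∉l → ¬free (j , j<n , 2≤j , j∉l))

injective⇒≤length : ∀ {A : Set} {m} {l : List A} (f : Fin m → A) → Injective _≡_ _≡_ f → (∀ i → f i ∈ l) → m ≤ length l
injective⇒≤length {l = l} f f-inj f∈l = ≮⇒≥ λ len<m →
  let (i , j , i<j , same-position) = pigeonhole len<m (Any.index ∘ f∈l)
      fi≡fj = trans (lookup-index (f∈l i)) (trans (cong (lookup l) same-position) (sym (lookup-index (f∈l j))))
  in <-irrefl (cong toℕ (f-inj fi≡fj)) i<j

<∸2⇒2+< : ∀ {i} n → i < n ∸ 2 → 2 + i < n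
<∸2⇒2+< (suc (suc n)) i<n = s≤s (s≤s i<n)

Crowded-length : ∀ n l → Crowded n l → n ∸ 2 ≤ length l
Crowded-length n l crowded =
  injective⇒≤length (λ i → 2 + toℕ i) (toℕ-injective ∘ +-cancelˡ-≡ 2 _ _)
    (λ i → crowded (<∸2⇒2+< n (toℕ<n i)) (m≤m+n 2 (toℕ i)))

indices-length : ∀ g → length (indices g) ≤ 2
indices-length (cyc _ _) = ≤-refl
indices-length (col _) = s≤s z≤n
indices-length (sq _) = s≤s z≤n

Crowded-bound : ∀ n x v t → Crowded n (x ∷ indices v ++ indices t) → n ∸ 2 ≤ 5
Crowded-bound n x v t crowded = ≤-trans (Crowded-length n _ crowded)
  (s≤s (≤-trans (≤-reflexive (length-++ (indices v))) (+-mono-≤ (indices-length v) (indices-length t))))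

-- The finite check

AllGen : ℕ → Pred Gen _ → Set
AllGen n P = ∀ g → InQ n g → P g

allGen? : ∀ n {P : Pred Gen _} → Decidable P → Dec (AllGen n P)
allGen? n {P} P? = map′ fromBounded toBounded
  (allUpTo? (λ y → allUpTo? (λ x → InQ? n (cyc y x) →-dec P? (cyc y x)) (suc n)) (suc n)
   ×-dec allUpTo? (λ x → InQ? n (col x) →-dec P? (col x)) (suc n)
   ×-dec allUpTo? (λ x → InQ? n (sq x) →-dec P? (sq x)) (suc n))
  where
  Bounded : Set
  Bounded = (∀ {y} → y < suc n → ∀ {x} → x < suc n → InQ n (cyc y x) → P (cyc y x))
          × (∀ {x} → x < suc n → InQ n (col x) → P (col x))
          × (∀ {x} → x < suc n → InQ n (sq x) → P (sq x))
  fromBounded : Bounded → AllGen n P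
  fromBounded (cycs , _ , _) (cyc y x) q@(_ , x<y , y≤n) = cycs (s≤s y≤n) (s≤s (≤-trans (<⇒≤ x<y) y≤n)) q
  fromBounded (_ , cols , _) (col x) q@(_ , x≤n) = cols (s≤s x≤n) q
  fromBounded (_ , _ , sqs) (sq x) q@(_ , x<n) = sqs (s≤s (<⇒≤ x<n)) q
  toBounded : AllGen n P → Bounded
  toBounded h = (λ _ _ → h _) , (λ _ → h _) , (λ _ → h _)

Verified : ℕ → Set
Verified n = ∀ {x} → x < n → 1 < x → AllGen n λ v → Rule n (sq x) v → AllGen n λ t →
             Crowded n (x ∷ indices v ++ indices t) → Rule n v t → T (is-just (rpathWithin 5 n (sq x ∷ v ∷ t ∷ [])))

verified? : ∀ n → Dec (Verified n)
verified? n = allUpTo? (λ x → 1 <? x →-dec allGen? n λ v → Rule? n (sq x) v →-dec allGen? n λ t →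
  crowded? n (x ∷ indices v ++ indices t) →-dec Rule? n v t →-dec T? (is-just (rpathWithin 5 n (sq x ∷ v ∷ t ∷ [])))) n

verified : ∀ n → n ∸ 2 ≤ 5 → Verified n
verified 0 _ = toWitness {a? = verified? 0} _
verified 1 _ = toWitness {a? = verified? 1} _
verified 2 _ = toWitness {a? = verified? 2} _
verified 3 _ = toWitness {a? = verified? 3} _
verified 4 _ = toWitness {a? = verified? 4} _
verified 5 _ = toWitness {a? = verified? 5} _
verified 6 _ = toWitness {a? = verified? 6} _
verified 7 _ = toWitness {a? = verified? 7} _
verified (suc (suc (suc (suc (suc (suc (suc (suc _)))))))) (s≤s (s≤s (s≤s (s≤s (s≤s ())))))

Verified-sound : ∀ {n x v t} → Verified n → Crowded n (x ∷ indices v ++ indices t) → TripleBound n (sq x) v t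
Verified-sound {n} {x} {v} {t} verifiedₙ crowded (1<x , x<n) qv qt r₁ r₂ =
  to-witness-T (rpathWithin 5 n (sq x ∷ v ∷ t ∷ [])) (verifiedₙ x<n 1<x v qv r₁ t qt crowded r₂)

tripleBound : ∀ n x v t → TripleBound n (sq x) v t
tripleBound n x v t with freeIndex? n (x ∷ indices v ++ indices t)
... | no ¬free = Verified-sound (verified n (Crowded-bound n x v t crowded)) crowded
  where
  crowded : Crowded n (x ∷ indices v ++ indices t)
  crowded = ¬FreeIndex⇒Crowded ¬free
tripleBound (suc n) x v t | yes (j , j<1+n , 2≤j , j∉) =
  subst (λ N → TripleBound N (sq x) v t) (shift-≥ (≤-pred j<1+n))
        (TripleBound-unshift n (sq x) v t j∉ (tripleBound n _ _ _))
  where open Insertion j 2≤j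

mainTheorem13 : (n : ℕ) (u v t : Gen) → InQ n u → InQ n v → InQ n t →
                (∃[ x ] (u ≡ sq x)) →
                ¬ IsNF n (u ∷ v ∷ []) → ¬ IsNF n (v ∷ t ∷ []) →
                ∃[ k ] (RPath n (u ∷ v ∷ t ∷ []) k × k ≤ 5)
mainTheorem13 n .(sq x) v t qu qv qt (x , refl) ¬nf₁ ¬nf₂ =
  tripleBound n x v t qu qv qt (¬IsNF⇒Rule ¬nf₁) (¬IsNF⇒Rule ¬nf₂)
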